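{- For every two-dimensional subgroup $\Lambda$ of $\mathbb{Z}\times\mathbb{Z}$ (i.e. one generated by two linearly independent vectors), there exist $n\in\mathbb{N}_+$ and binary trees $T,T'\in\mathcal{T}_n$ such that $\Lambda_{T,T'}=\Lambda$.
   Context: A binary tree is a finite rooted plane tree in which every internal vertex has exactly two ordered children (left and right); $\mathcal{T}_n$ is the set of binary trees with $n$ leaves, numbered $1,\dots,n$ left to right. $\mathrm{ld}_T(i)$ and $\mathrm{rd}_T(i)$ are the numbers of left and right steps on the path from the root to leaf $i$. $\Lambda_{T,T'}$ is the subgroup of $\mathbb{Z}\times\mathbb{Z}$ generated by $\{(\mathrm{ld}_T(i)-\mathrm{ld}_{T'}(i),\mathrm{rd}_T(i)-\mathrm{rd}_{T'}(i)):i=1,\dots,n\}$. -}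

module Defs where

open import Data.Nat using (ℕ; zero; suc) renaming (_+_ to _+ℕ_)
open import Data.Integer using (ℤ; +_; _+_; _-_; _*_; 0ℤ)
open import Data.Product using (_×_; _,_; ∃)
open import Data.Vec using (Vec; []; _∷_; _++_; map; zipWith)
open import Relation.Binary.PropositionalEquality using (_≡_)

data Tree : ℕ → Set where
  leaf : Tree 1
  node : ∀ {m n} → Tree m → Tree n → Tree (m +ℕ n)

-- (ld(i), rd(i)) for the leaves i = 1..n, listed left to right:
-- numbers of left and right steps on the path from the root to leaf i.
depths : ∀ {n} → Tree n → Vec (ℕ × ℕ) n
depths leaf = (0 , 0) ∷ []
depths (node l r) =
  map (λ { (a , b) → (suc a , b) }) (depths l)
  ++ map (λ { (a , b) → (a , suc b) }) (depths r)

ℤ² : Set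
ℤ² = ℤ × ℤ

_+²_ : ℤ² → ℤ² → ℤ²
(a , b) +² (c , d) = (a + c , b + d)

_·²_ : ℤ → ℤ² → ℤ²
k ·² (a , b) = (k * a , k * b)

lincomb : ∀ {k} → Vec ℤ k → Vec ℤ² k → ℤ²
lincomb [] [] = (0ℤ , 0ℤ)
lincomb (c ∷ cs) (g ∷ gs) = (c ·² g) +² lincomb cs gs

InSpan : ∀ {k} → Vec ℤ² k → ℤ² → Set
InSpan {k} gs v = ∃ λ (cs : Vec ℤ k) → lincomb cs gs ≡ v

diffVec : ℕ × ℕ → ℕ × ℕ → ℤ²
diffVec (a , b) (a' , b') = ((+ a) - (+ a') , (+ b) - (+ b'))

lambdaGens : ∀ {n} → Tree n → Tree n → Vec ℤ² n
lambdaGens T T' = zipWith diffVec (depths T) (depths T')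

InΛ : ∀ {n} → Tree n → Tree n → ℤ² → Set
InΛ T T' = InSpan (lambdaGens T T')

-- determinant of two vectors (nonzero iff linearly independent over ℚ)
det : ℤ² → ℤ² → ℤ
det (a , b) (c , d) = a * d - b * c

module Submission where

-- For trees A, A′ with equally many leaves and any B, B′, the lattice of
-- (node A B , node A′ B′) is the sum of the lattices of (A , A′) and (B , B′):
-- the common first step cancels in every difference.  If Λ = ⟨u , w⟩ with
-- D = det u w ≠ 0, then Cramer's rule gives M ℤ² ⊆ Λ for M = |D|.  Every x ∈ Λ
-- is congruent modulo M ℤ² to some V = (m , -k) with m, k ∈ ℕ, and a pair of
-- trees built from combs has difference vectors 0, -Me₁, V - Me₁, V, V + Me₂
-- and Me₂ only, so its lattice ⟨Me₁ , Me₂ , V⟩ contains x and lies in Λ.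
-- Gluing the pairs for u and w under a common root realises Λ.

open import Defs
open import Data.Nat as ℕ using (ℕ; zero; suc; _>_; s≤s; z≤n)
import Data.Nat.Properties as ℕ
import Data.Nat.Tactic.RingSolver as ℕ-Solver
open import Data.Integer as ℤ using (ℤ; +_; -[1+_]; _+_; _-_; _*_; -_; _%ℕ_; _/ℕ_; 0ℤ; 1ℤ; -1ℤ)
import Data.Integer.Properties as ℤ
import Data.Integer.DivMod as ℤ
open import Data.Integer.Tactic.RingSolver using (solve-∀)
open import Data.Product using (Σ; ∃; _×_; _,_; proj₁; proj₂)
open import Data.Vec as Vec using (Vec; []; _∷_)
import Data.Vec.Properties as Vec
open import Data.Vec.Membership.Propositional using () renaming (_∈_ to _∈ᵥ_)
open import Data.Vec.Membership.Propositional.Properties using (∈-toList⁺; ∈-toList⁻; ∈-fromList⁺; ∈-fromList⁻)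
open import Data.List as List using (List; []; _∷_; _++_; length; zipWith; replicate)
import Data.List.Properties as List
open import Data.List.Relation.Unary.All as All using (All; []; _∷_)
import Data.List.Relation.Unary.All.Properties as All
open import Data.List.Relation.Unary.Any using (here; there)
open import Data.Vec.Relation.Unary.Any using () renaming (here to hereᵥ; there to thereᵥ)
open import Data.List.Membership.Propositional using (_∈_)
open import Data.List.Membership.Propositional.Properties using (∈-++⁺ˡ; ∈-++⁺ʳ)
open import Data.Empty using (⊥-elim)
open import Function.Bundles using (_⇔_; mk⇔)
open import Function.Construct.Composition using (_⇔-∘_)
open import Function.Base using (_∘_)
open import Relation.Binary.PropositionalEquality

zipWith-++ : ∀ {A B C : Set} (f : A → B → C) xs ys {xs′ ys′} → length xs ≡ length xs′ →
             zipWith f (xs ++ ys) (xs′ ++ ys′) ≡ zipWith f xs xs′ ++ zipWith f ys ys′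
zipWith-++ f []       ys {[]}      _  = refl
zipWith-++ f (x ∷ xs) ys {x′ ∷ xs′} eq = cong (f x x′ ∷_) (zipWith-++ f xs ys (ℕ.suc-injective eq))

replicate-++-∷ : ∀ {A : Set} n (x : A) xs → replicate n x ++ x ∷ xs ≡ x ∷ replicate n x ++ xs
replicate-++-∷ zero    x xs = refl
replicate-++-∷ (suc n) x xs = cong (x ∷_) (replicate-++-∷ n x xs)

toList-zipWith : ∀ {A B C : Set} {n} (f : A → B → C) (xs : Vec A n) ys →
                 Vec.toList (Vec.zipWith f xs ys) ≡ zipWith f (Vec.toList xs) (Vec.toList ys)
toList-zipWith f []       []       = refl
toList-zipWith f (x ∷ xs) (y ∷ ys) = cong (f x y ∷_) (toList-zipWith f xs ys)

0² : ℤ²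
0² = (0ℤ , 0ℤ)

-1·²-involutive : ∀ v → -1ℤ ·² (-1ℤ ·² v) ≡ v
-1·²-involutive (a , b) = cong₂ _,_ (neg-neg a) (neg-neg b)
  where
  neg-neg : ∀ a → -1ℤ * (-1ℤ * a) ≡ a
  neg-neg = solve-∀

+²-cancelʳ : ∀ u v → (u +² v) +² (-1ℤ ·² v) ≡ u
+²-cancelʳ (a , b) (c , d) = cong₂ _,_ (cancel a c) (cancel b d)
  where
  cancel : ∀ a c → a + c + -1ℤ * c ≡ a
  cancel = solve-∀

[c+m]-[c+n]≡m-n : ∀ c m n → + (c ℕ.+ m) - + (c ℕ.+ n) ≡ + m - + n
[c+m]-[c+n]≡m-n c m n = begin
  + (c ℕ.+ m) - + (c ℕ.+ n) ≡⟨ ℤ.m-n≡m⊖n (c ℕ.+ m) (c ℕ.+ n) ⟩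
  (c ℕ.+ m) ℤ.⊖ (c ℕ.+ n)   ≡⟨ ℤ.+-cancelˡ-⊖ c m n ⟩
  m ℤ.⊖ n                   ≡⟨ ℤ.m-n≡m⊖n m n ⟨
  + m - + n                 ∎
  where open ≡-Reasoning

lincomb-zeros : ∀ {n} (gs : Vec ℤ² n) → lincomb (Vec.replicate n 0ℤ) gs ≡ 0²
lincomb-zeros []             = refl
lincomb-zeros ((a , b) ∷ gs) rewrite lincomb-zeros gs = refl

lincomb-+ : ∀ {n} (cs ds : Vec ℤ n) (gs : Vec ℤ² n) →
            lincomb (Vec.zipWith _+_ cs ds) gs ≡ lincomb cs gs +² lincomb ds gs
lincomb-+ []       []       []             = refl
lincomb-+ (c ∷ cs) (d ∷ ds) ((a , b) ∷ gs) rewrite lincomb-+ cs ds gs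
  with lincomb cs gs | lincomb ds gs
... | x , y | x′ , y′ = cong₂ _,_ (interchange c d a x x′) (interchange c d b y y′)
  where
  interchange : ∀ c d a x x′ → (c + d) * a + (x + x′) ≡ (c * a + x) + (d * a + x′)
  interchange = solve-∀

lincomb-* : ∀ {n} k (cs : Vec ℤ n) (gs : Vec ℤ² n) →
            lincomb (Vec.map (k *_) cs) gs ≡ k ·² lincomb cs gs
lincomb-* k []       []             = sym (cong₂ _,_ (ℤ.*-zeroʳ k) (ℤ.*-zeroʳ k))
lincomb-* k (c ∷ cs) ((a , b) ∷ gs) rewrite lincomb-* k cs gs
  with lincomb cs gs
... | x , y = cong₂ _,_ (distrib k c a x) (distrib k c b y)
  where
  distrib : ∀ k c a x → k * c * a + k * x ≡ k * (c * a + x)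
  distrib = solve-∀

module _ {n} {gs : Vec ℤ² n} where

  InSpan-zero : InSpan gs 0²
  InSpan-zero = Vec.replicate n 0ℤ , lincomb-zeros gs

  InSpan-+ : ∀ {u v} → InSpan gs u → InSpan gs v → InSpan gs (u +² v)
  InSpan-+ (cs , refl) (ds , refl) = Vec.zipWith _+_ cs ds , lincomb-+ cs ds gs

  InSpan-* : ∀ k {v} → InSpan gs v → InSpan gs (k ·² v)
  InSpan-* k (cs , refl) = Vec.map (k *_) cs , lincomb-* k cs gs

  InSpan-cancelʳ : ∀ {u v} → InSpan gs (u +² v) → InSpan gs v → InSpan gs u
  InSpan-cancelʳ {u} {v} u+v∈ v∈ =
    subst (InSpan gs) (+²-cancelʳ u v) (InSpan-+ u+v∈ (InSpan-* -1ℤ v∈))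

InSpan-∈ : ∀ {n} {gs : Vec ℤ² n} {g} → g ∈ᵥ gs → InSpan gs g
InSpan-∈ {gs = (a , b) ∷ gs} (hereᵥ refl) = 1ℤ ∷ Vec.replicate _ 0ℤ , first-basis-vector
  where
  unit : ∀ a → 1ℤ * a + 0ℤ ≡ a
  unit = solve-∀
  first-basis-vector : lincomb (1ℤ ∷ Vec.replicate _ 0ℤ) ((a , b) ∷ gs) ≡ (a , b)
  first-basis-vector rewrite lincomb-zeros gs = cong₂ _,_ (unit a) (unit b)
InSpan-∈ {gs = _ ∷ _} (thereᵥ g∈) with InSpan-∈ g∈
... | cs , refl = 0ℤ ∷ cs , cong₂ _,_ (ℤ.+-identityˡ _) (ℤ.+-identityˡ _)

InSpan-mono : ∀ {m n} {gs : Vec ℤ² m} {hs : Vec ℤ² n} →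
              (∀ {g} → g ∈ᵥ gs → InSpan hs g) → ∀ {v} → InSpan gs v → InSpan hs v
InSpan-mono {gs = []}     gs⊆ ([] , refl)     = InSpan-zero
InSpan-mono {gs = g ∷ gs} gs⊆ (c ∷ cs , refl) =
  InSpan-+ (InSpan-* c (gs⊆ (hereᵥ refl))) (InSpan-mono (gs⊆ ∘ thereᵥ) (cs , refl))

InSpan-⇔ : ∀ {m n} {gs : Vec ℤ² m} {hs : Vec ℤ² n} →
           (∀ {g} → g ∈ᵥ gs → InSpan hs g) → (∀ {h} → h ∈ᵥ hs → InSpan gs h) →
           ∀ {v} → InSpan gs v ⇔ InSpan hs v
InSpan-⇔ gs⊆ hs⊆ = mk⇔ (InSpan-mono gs⊆) (InSpan-mono hs⊆)

⟨_⟩ : List ℤ² → ℤ² → Set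
⟨ L ⟩ = InSpan (Vec.fromList L)

⟨⟩-∈ : ∀ {L g} → g ∈ L → ⟨ L ⟩ g
⟨⟩-∈ g∈ = InSpan-∈ (∈-fromList⁺ g∈)

⟨⟩-⊆ : ∀ {L L′} → (∀ {g} → g ∈ L → g ∈ L′) → ∀ {v} → ⟨ L ⟩ v → ⟨ L′ ⟩ v
⟨⟩-⊆ L⊆L′ = InSpan-mono (λ g∈ → ⟨⟩-∈ (L⊆L′ (∈-fromList⁻ g∈)))

-- Leaf depths of T hanging from a vertex of depth (a , b), consed onto ps;
-- the accumulator lets spines unfold by computation.
depthsFrom : ∀ {n} → ℕ → ℕ → Tree n → List (ℕ × ℕ) → List (ℕ × ℕ)
depthsFrom a b leaf       ps = (a , b) ∷ ps
depthsFrom a b (node l r) ps = depthsFrom (suc a) b l (depthsFrom a (suc b) r ps)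

gens : ∀ {m n} → Tree m → Tree n → List ℤ²
gens T T′ = zipWith diffVec (depthsFrom 0 0 T []) (depthsFrom 0 0 T′ [])

depthsFrom-++ : ∀ {n} a b (T : Tree n) ps → depthsFrom a b T ps ≡ depthsFrom a b T [] ++ ps
depthsFrom-++ a b leaf       ps = refl
depthsFrom-++ a b (node l r) ps = begin
  depthsFrom (suc a) b l (depthsFrom a (suc b) r ps)
    ≡⟨ depthsFrom-++ (suc a) b l _ ⟩
  depthsFrom (suc a) b l [] ++ depthsFrom a (suc b) r ps
    ≡⟨ cong (depthsFrom (suc a) b l [] ++_) (depthsFrom-++ a (suc b) r ps) ⟩
  depthsFrom (suc a) b l [] ++ depthsFrom a (suc b) r [] ++ ps
    ≡⟨ List.++-assoc (depthsFrom (suc a) b l []) _ ps ⟨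
  (depthsFrom (suc a) b l [] ++ depthsFrom a (suc b) r []) ++ ps
    ≡⟨ cong (_++ ps) (depthsFrom-++ (suc a) b l _) ⟨
  depthsFrom (suc a) b l (depthsFrom a (suc b) r []) ++ ps ∎
  where open ≡-Reasoning

length-depthsFrom : ∀ {n} a b (T : Tree n) ps → length (depthsFrom a b T ps) ≡ n ℕ.+ length ps
length-depthsFrom a b leaf                 ps = refl
length-depthsFrom a b (node {m} {n} l r) ps =
  trans (length-depthsFrom (suc a) b l _)
  (trans (cong (m ℕ.+_) (length-depthsFrom a (suc b) r ps)) (sym (ℕ.+-assoc m n (length ps))))

shift : ℕ → ℕ → ℕ × ℕ → ℕ × ℕ
shift a b (x , y) = (a ℕ.+ x , b ℕ.+ y)

map-shift-depthsFrom : ∀ {n} a b c d (T : Tree n) ps →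
  List.map (shift a b) (depthsFrom c d T ps) ≡ depthsFrom (a ℕ.+ c) (b ℕ.+ d) T (List.map (shift a b) ps)
map-shift-depthsFrom a b c d leaf       ps = refl
map-shift-depthsFrom a b c d (node l r) ps =
  trans (map-shift-depthsFrom a b (suc c) d l _)
  (trans (cong (depthsFrom (a ℕ.+ suc c) (b ℕ.+ d) l) (map-shift-depthsFrom a b c (suc d) r ps))
    (cong₂ (λ i j → depthsFrom i (b ℕ.+ d) l (depthsFrom (a ℕ.+ c) j r (List.map (shift a b) ps)))
      (ℕ.+-suc a c) (ℕ.+-suc b d)))

depthsFrom-shift : ∀ {n} a b (T : Tree n) → depthsFrom a b T [] ≡ List.map (shift a b) (depthsFrom 0 0 T [])
depthsFrom-shift a b T = sym (trans (map-shift-depthsFrom a b 0 0 T [])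
  (cong₂ (λ i j → depthsFrom i j T []) (ℕ.+-identityʳ a) (ℕ.+-identityʳ b)))

diffVec-shift : ∀ a b p q → diffVec (shift a b p) (shift a b q) ≡ diffVec p q
diffVec-shift a b (x , y) (x′ , y′) = cong₂ _,_ ([c+m]-[c+n]≡m-n a x x′) ([c+m]-[c+n]≡m-n b y y′)

zipWith-depthsFrom : ∀ {n} a b (T T′ : Tree n) ps qs →
  zipWith diffVec (depthsFrom a b T ps) (depthsFrom a b T′ qs) ≡ gens T T′ ++ zipWith diffVec ps qs
zipWith-depthsFrom {n} a b T T′ ps qs = begin
  zipWith diffVec (depthsFrom a b T ps) (depthsFrom a b T′ qs)
    ≡⟨ cong₂ (zipWith diffVec) (depthsFrom-++ a b T ps) (depthsFrom-++ a b T′ qs) ⟩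
  zipWith diffVec (depthsFrom a b T [] ++ ps) (depthsFrom a b T′ [] ++ qs)
    ≡⟨ zipWith-++ diffVec (depthsFrom a b T []) ps
         (trans (length-depthsFrom a b T []) (sym (length-depthsFrom a b T′ []))) ⟩
  zipWith diffVec (depthsFrom a b T []) (depthsFrom a b T′ []) ++ zipWith diffVec ps qs
    ≡⟨ cong (_++ zipWith diffVec ps qs) shifted ⟩
  gens T T′ ++ zipWith diffVec ps qs ∎
  where
  open ≡-Reasoning
  shifted : zipWith diffVec (depthsFrom a b T []) (depthsFrom a b T′ []) ≡ gens T T′
  shifted = trans (cong₂ (zipWith diffVec) (depthsFrom-shift a b T) (depthsFrom-shift a b T′))
    (trans (List.zipWith-map diffVec (shift a b) (shift a b) _ _)
      (List.zipWith-cong (λ p q → diffVec-shift a b p q) (depthsFrom 0 0 T []) (depthsFrom 0 0 T′ [])))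

gens-node : ∀ {m n} (A A′ : Tree m) (B B′ : Tree n) →
            gens (node A B) (node A′ B′) ≡ gens A A′ ++ gens B B′
gens-node A A′ B B′ = trans (zipWith-depthsFrom 1 0 A A′ _ _)
  (cong (gens A A′ ++_) (trans (zipWith-depthsFrom 0 1 B B′ [] []) (List.++-identityʳ (gens B B′))))

toList-map-shift : ∀ {k} {f : ℕ × ℕ → ℕ × ℕ} a b (ds : Vec (ℕ × ℕ) k) {D} →
  (∀ p → f p ≡ shift a b p) → Vec.toList ds ≡ D → Vec.toList (Vec.map f ds) ≡ List.map (shift a b) D
toList-map-shift {f = f} a b ds f≗shift refl =
  trans (Vec.toList-map f ds) (List.map-cong f≗shift (Vec.toList ds))

toList-depths : ∀ {n} (T : Tree n) → Vec.toList (depths T) ≡ depthsFrom 0 0 T []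
toList-depths leaf       = refl
toList-depths (node l r) =
  trans (Vec.toList-++ (Vec.map _ (depths l)) (Vec.map _ (depths r)))
  (trans (cong₂ _++_
      (trans (toList-map-shift 1 0 (depths l) (λ { (x , y) → refl }) (toList-depths l))
        (map-shift-depthsFrom 1 0 0 0 l []))
      (trans (toList-map-shift 0 1 (depths r) (λ { (x , y) → refl }) (toList-depths r))
        (map-shift-depthsFrom 0 1 0 0 r [])))
    (sym (depthsFrom-++ 1 0 l _)))

toList-lambdaGens : ∀ {n} (T T′ : Tree n) → Vec.toList (lambdaGens T T′) ≡ gens T T′
toList-lambdaGens T T′ = trans (toList-zipWith diffVec (depths T) (depths T′))
  (cong₂ (zipWith diffVec) (toList-depths T) (toList-depths T′))

InΛ⇔⟨gens⟩ : ∀ {n} (T T′ : Tree n) {v} → InΛ T T′ v ⇔ ⟨ gens T T′ ⟩ v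
InΛ⇔⟨gens⟩ T T′ = InSpan-⇔
  (λ g∈ → ⟨⟩-∈ (subst (_ ∈_) (toList-lambdaGens T T′) (∈-toList⁺ g∈)))
  (λ g∈ → InSpan-∈ (∈-toList⁻ (subst (_ ∈_) (sym (toList-lambdaGens T T′)) (∈-fromList⁻ g∈))))

size>0 : ∀ {n} → Tree n → n > 0
size>0 leaf               = s≤s z≤n
size>0 (node {m} {n} l r) = ℕ.<-≤-trans (size>0 l) (ℕ.m≤m+n m n)

record TreePair : Set where
  field
    size        : ℕ
    left right  : Tree size
open TreePair

generators : TreePair → List ℤ²
generators P = gens (left P) (right P)

Λ : TreePair → ℤ² → Set
Λ P = ⟨ generators P ⟩

pairOf : ∀ {m n} → m ≡ n → Tree m → Tree n → TreePair
pairOf refl T T′ = record { size = _ ; left = T ; right = T′ }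

generators-pairOf : ∀ {m n} (m≡n : m ≡ n) (T : Tree m) (T′ : Tree n) →
                    generators (pairOf m≡n T T′) ≡ gens T T′
generators-pairOf refl T T′ = refl

_⊗_ : TreePair → TreePair → TreePair
P ⊗ Q = record { size = _ ; left = node (left P) (left Q) ; right = node (right P) (right Q) }

generators-⊗ : ∀ P Q → generators (P ⊗ Q) ≡ generators P ++ generators Q
generators-⊗ P Q = gens-node (left P) (right P) (left Q) (right Q)

Λ-⊗ˡ : ∀ P Q {v} → Λ P v → Λ (P ⊗ Q) v
Λ-⊗ˡ P Q = ⟨⟩-⊆ (λ g∈ → subst (_ ∈_) (sym (generators-⊗ P Q)) (∈-++⁺ˡ g∈))

Λ-⊗ʳ : ∀ P Q {v} → Λ Q v → Λ (P ⊗ Q) v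
Λ-⊗ʳ P Q = ⟨⟩-⊆ (λ g∈ → subst (_ ∈_) (sym (generators-⊗ P Q)) (∈-++⁺ʳ (generators P) g∈))

-- m + n, recursing on m so that  leftSpine (suc m) X  is literally a node.
_+ˡ_ : ℕ → ℕ → ℕ
zero  +ˡ n = n
suc m +ˡ n = (m +ˡ n) ℕ.+ 1

+ˡ≡+ : ∀ m n → m +ˡ n ≡ m ℕ.+ n
+ˡ≡+ zero    n = refl
+ˡ≡+ (suc m) n = trans (cong (ℕ._+ 1) (+ˡ≡+ m n)) (ℕ.+-comm (m ℕ.+ n) 1)

rightSpine : ∀ k {n} → Tree n → Tree (k ℕ.+ n)
rightSpine zero    X = X
rightSpine (suc k) X = node leaf (rightSpine k X)

leftSpine : ∀ m {n} → Tree n → Tree (m +ˡ n)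
leftSpine zero    X = X
leftSpine (suc m) X = node (leftSpine m X) leaf

rightColumn : ℕ → ℕ → ℕ → List (ℕ × ℕ) → List (ℕ × ℕ)
rightColumn a b zero    ps = ps
rightColumn a b (suc k) ps = (suc a , b) ∷ rightColumn a (suc b) k ps

leftColumn : ℕ → ℕ → ℕ → List (ℕ × ℕ) → List (ℕ × ℕ)
leftColumn a b zero    ps = ps
leftColumn a b (suc m) ps = leftColumn (suc a) b m ((a , suc b) ∷ ps)

depthsFrom-rightSpine : ∀ {n} a b k (X : Tree n) ps →
  depthsFrom a b (rightSpine k X) ps ≡ rightColumn a b k (depthsFrom a (b ℕ.+ k) X ps)
depthsFrom-rightSpine a b zero    X ps = cong (λ j → depthsFrom a j X ps) (sym (ℕ.+-identityʳ b))
depthsFrom-rightSpine a b (suc k) X ps = cong ((suc a , b) ∷_)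
  (trans (depthsFrom-rightSpine a (suc b) k X ps)
    (cong (λ j → rightColumn a (suc b) k (depthsFrom a j X ps)) (sym (ℕ.+-suc b k))))

depthsFrom-leftSpine : ∀ {n} a b m (X : Tree n) ps →
  depthsFrom a b (leftSpine m X) ps ≡ depthsFrom (a ℕ.+ m) b X (leftColumn a b m ps)
depthsFrom-leftSpine a b zero    X ps = cong (λ i → depthsFrom i b X ps) (sym (ℕ.+-identityʳ a))
depthsFrom-leftSpine a b (suc m) X ps =
  trans (depthsFrom-leftSpine (suc a) b m X ((a , suc b) ∷ ps))
    (cong (λ i → depthsFrom i b X (leftColumn a b (suc m) ps)) (sym (ℕ.+-suc a m)))

zipWith-rightColumn : ∀ a b a′ b′ k ps qs →
  zipWith diffVec (rightColumn a b k ps) (rightColumn a′ b′ k qs)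
    ≡ replicate k (diffVec (a , b) (a′ , b′)) ++ zipWith diffVec ps qs
zipWith-rightColumn a b a′ b′ zero    ps qs = refl
zipWith-rightColumn a b a′ b′ (suc k) ps qs = cong₂ _∷_ (diffVec-shift 1 0 (a , b) (a′ , b′))
  (trans (zipWith-rightColumn a (suc b) a′ (suc b′) k ps qs)
    (cong (λ d → replicate k d ++ zipWith diffVec ps qs) (diffVec-shift 0 1 (a , b) (a′ , b′))))

zipWith-leftColumn : ∀ a b a′ b′ m ps qs →
  zipWith diffVec (leftColumn a b m ps) (leftColumn a′ b′ m qs)
    ≡ replicate m (diffVec (a , b) (a′ , b′)) ++ zipWith diffVec ps qs
zipWith-leftColumn a b a′ b′ zero    ps qs = refl
zipWith-leftColumn a b a′ b′ (suc m) ps qs = begin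
  zipWith diffVec (leftColumn (suc a) b m ((a , suc b) ∷ ps)) (leftColumn (suc a′) b′ m ((a′ , suc b′) ∷ qs))
    ≡⟨ zipWith-leftColumn (suc a) b (suc a′) b′ m _ _ ⟩
  replicate m (diffVec (suc a , b) (suc a′ , b′)) ++ diffVec (a , suc b) (a′ , suc b′) ∷ zipWith diffVec ps qs
    ≡⟨ cong₂ (λ d e → replicate m d ++ e ∷ zipWith diffVec ps qs)
         (diffVec-shift 1 0 (a , b) (a′ , b′)) (diffVec-shift 0 1 (a , b) (a′ , b′)) ⟩
  replicate m d ++ d ∷ zipWith diffVec ps qs
    ≡⟨ replicate-++-∷ m d _ ⟩
  d ∷ replicate m d ++ zipWith diffVec ps qs ∎
  where
  open ≡-Reasoning
  d = diffVec (a , b) (a′ , b′)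

-- The gadget

module Gadget (k m p : ℕ) where

  M : ℕ
  M = suc p

  horizontal vertical V : ℤ²
  horizontal = (+ M , 0ℤ)
  vertical   = (0ℤ , + M)
  V          = (+ m , - + k)

  private
    Z : Tree (p ℕ.+ (M +ˡ 1))
    Z = rightSpine p (leftSpine M leaf)

    Z′ : Tree (p +ˡ (M ℕ.+ 1))
    Z′ = leftSpine p (rightSpine M leaf)

    A : Tree ((k ℕ.+ 1) ℕ.+ (m +ˡ (p ℕ.+ (M +ˡ 1))))
    A = node (rightSpine k leaf) (leftSpine m Z)

    B : Tree ((k ℕ.+ (p +ˡ (M ℕ.+ 1))) ℕ.+ (m +ˡ 1))
    B = node (rightSpine k Z′) (leftSpine m leaf)

    size-A≡size-B : (k ℕ.+ 1) ℕ.+ (m +ˡ (p ℕ.+ (M +ˡ 1))) ≡ (k ℕ.+ (p +ˡ (M ℕ.+ 1))) ℕ.+ (m +ˡ 1)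
    size-A≡size-B rewrite +ˡ≡+ M 1 | +ˡ≡+ m (p ℕ.+ (M ℕ.+ 1)) | +ˡ≡+ p (M ℕ.+ 1) | +ˡ≡+ m 1 =
      sizes k m p
      where
      sizes : ∀ k m p → (k ℕ.+ 1) ℕ.+ (m ℕ.+ (p ℕ.+ (suc p ℕ.+ 1)))
                        ≡ (k ℕ.+ (p ℕ.+ (suc p ℕ.+ 1))) ℕ.+ (m ℕ.+ 1)
      sizes = ℕ-Solver.solve-∀

  gadget : TreePair
  gadget = pairOf size-A≡size-B A B

  private
    L : List (ℕ × ℕ)
    L = leftColumn 0 1 m []

    depths-A : depthsFrom 0 0 A [] ≡
      rightColumn 1 0 k ((1 , k) ∷ rightColumn m 1 p ((m ℕ.+ M , M) ∷ leftColumn (suc m) M p ((m , suc M) ∷ L)))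
    depths-A = trans (depthsFrom-rightSpine 1 0 k leaf _)
      (cong (λ ps → rightColumn 1 0 k ((1 , k) ∷ ps))
        (trans (depthsFrom-leftSpine 0 1 m Z [])
          (trans (depthsFrom-rightSpine m 1 p (leftSpine M leaf) L)
            (cong (rightColumn m 1 p) (depthsFrom-leftSpine m M M leaf L)))))

    depths-B : depthsFrom 0 0 B [] ≡
      rightColumn 1 0 k ((suc M , k) ∷ rightColumn M (suc k) p ((M , k ℕ.+ M) ∷ leftColumn 1 k p ((m , 1) ∷ L)))
    depths-B = trans (depthsFrom-rightSpine 1 0 k Z′ _)
      (cong (rightColumn 1 0 k)
        (trans (cong (depthsFrom 1 k Z′) (depthsFrom-leftSpine 0 1 m leaf []))
          (trans (depthsFrom-leftSpine 1 k p (rightSpine M leaf) _) (depthsFrom-rightSpine M k M leaf _))))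

    d₁ d₂ d₃ d₄ d₅ : ℤ²
    d₁ = diffVec (1 , k) (suc M , k)
    d₂ = diffVec (m , 1) (M , suc k)
    d₃ = diffVec (m ℕ.+ M , M) (M , k ℕ.+ M)
    d₄ = diffVec (suc m , M) (1 , k)
    d₅ = diffVec (m , suc M) (m , 1)

    G : List ℤ²
    G = replicate k 0² ++ d₁ ∷ replicate p d₂ ++ d₃ ∷ replicate p d₄ ++ d₅ ∷ replicate m 0²

    generators-gadget : generators gadget ≡ G
    generators-gadget = trans (generators-pairOf size-A≡size-B A B)
      (trans (cong₂ (zipWith diffVec) depths-A depths-B)
      (trans (zipWith-rightColumn 1 0 1 0 k _ _)
      (cong (λ zs → replicate k 0² ++ d₁ ∷ zs) (trans (zipWith-rightColumn m 1 M (suc k) p _ _)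
      (cong (λ zs → replicate p d₂ ++ d₃ ∷ zs) (trans (zipWith-leftColumn (suc m) M 1 k p _ _)
      (cong (λ zs → replicate p d₄ ++ d₅ ∷ zs)
        (trans (zipWith-leftColumn 0 1 0 1 m [] []) (List.++-identityʳ _)))))))))

    d₁≡ : d₁ ≡ -1ℤ ·² horizontal
    d₁≡ = cong₂ _,_ (sym (ℤ.-1*i≡-i (+ M))) (ℤ.+-inverseʳ (+ k))

    d₂≡ : d₂ ≡ V +² (-1ℤ ·² horizontal)
    d₂≡ = cong₂ _,_ (cong (λ i → + m + i) (sym (ℤ.-1*i≡-i (+ M))))
                    (trans ([c+m]-[c+n]≡m-n 1 0 k) (ℤ.+-comm 0ℤ (- + k)))

    d₃≡ : d₃ ≡ V
    d₃≡ = cong₂ _,_ (trans (cong (_- + M) (ℤ.pos-+ m M)) (cancel (+ m) (+ M)))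
                    (trans (cong (λ i → + M - i) (ℤ.pos-+ k M)) (cancel′ (+ k) (+ M)))
      where
      cancel : ∀ a b → a + b - b ≡ a
      cancel = solve-∀
      cancel′ : ∀ a b → b - (a + b) ≡ - a
      cancel′ = solve-∀

    d₄≡ : d₄ ≡ V +² vertical
    d₄≡ = cong₂ _,_ ([c+m]-[c+n]≡m-n 1 m 0) (ℤ.+-comm (+ M) (- + k))

    d₅≡ : d₅ ≡ vertical
    d₅≡ = cong₂ _,_ (ℤ.+-inverseʳ (+ m)) refl

    Λ-∈ : ∀ {d} → d ∈ G → Λ gadget d
    Λ-∈ d∈ = ⟨⟩-∈ (subst (_ ∈_) (sym generators-gadget) d∈)

  generators⊆ : ∀ {n} {gs : Vec ℤ² n} →
    InSpan gs horizontal → InSpan gs vertical → InSpan gs V → All (InSpan gs) (generators gadget)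
  generators⊆ {gs = gs} h∈ v∈ V∈ = subst (All (InSpan gs)) (sym generators-gadget)
    (All.++⁺ (All.replicate⁺ k InSpan-zero)
    (d₁∈ ∷ All.++⁺ (All.replicate⁺ p d₂∈)
    (d₃∈ ∷ All.++⁺ (All.replicate⁺ p d₄∈)
    (d₅∈ ∷ All.replicate⁺ m InSpan-zero))))
    where
    d₁∈ = subst (InSpan gs) (sym d₁≡) (InSpan-* -1ℤ h∈)
    d₂∈ = subst (InSpan gs) (sym d₂≡) (InSpan-+ V∈ (InSpan-* -1ℤ h∈))
    d₃∈ = subst (InSpan gs) (sym d₃≡) V∈
    d₄∈ = subst (InSpan gs) (sym d₄≡) (InSpan-+ V∈ v∈)
    d₅∈ = subst (InSpan gs) (sym d₅≡) v∈

  horizontal∈Λ : Λ gadget horizontal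
  horizontal∈Λ = subst (Λ gadget) (trans (cong (-1ℤ ·²_) d₁≡) (-1·²-involutive horizontal))
    (InSpan-* -1ℤ (Λ-∈ (∈-++⁺ʳ (replicate k 0²) (here refl))))

  V∈Λ : Λ gadget V
  V∈Λ = subst (Λ gadget) d₃≡
    (Λ-∈ (∈-++⁺ʳ (replicate k 0²) (there (∈-++⁺ʳ (replicate p d₂) (here refl)))))

  vertical∈Λ : Λ gadget vertical
  vertical∈Λ = subst (Λ gadget) d₅≡
    (Λ-∈ (∈-++⁺ʳ (replicate k 0²) (there (∈-++⁺ʳ (replicate p d₂)
      (there (∈-++⁺ʳ (replicate p d₄) (here refl)))))))

-- Reduction modulo M ℤ²

-- The quadrant ℕ × (- ℕ) is the one the gadget realises.
residue : ∀ M .{{_ : ℕ.NonZero M}} (x : ℤ²) → ∃ λ m → ∃ λ k → ∃ λ q₁ → ∃ λ q₂ →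
          x ≡ (+ m , - + k) +² ((q₁ ·² (+ M , 0ℤ)) +² (q₂ ·² (0ℤ , + M)))
residue M (x₁ , x₂) =
  x₁ %ℕ M , (- x₂) %ℕ M , x₁ /ℕ M , - ((- x₂) /ℕ M) , cong₂ _,_ first second
  where
  first : x₁ ≡ + (x₁ %ℕ M) + (x₁ /ℕ M * + M + - ((- x₂) /ℕ M) * 0ℤ)
  first = trans (ℤ.a≡a%ℕn+[a/ℕn]*n x₁ M) (shape (+ (x₁ %ℕ M)) (x₁ /ℕ M) (- ((- x₂) /ℕ M)) (+ M))
    where
    shape : ∀ r q q′ M → r + q * M ≡ r + (q * M + q′ * 0ℤ)
    shape = solve-∀
  second : x₂ ≡ - + ((- x₂) %ℕ M) + (x₁ /ℕ M * 0ℤ + - ((- x₂) /ℕ M) * + M)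
  second = begin
    x₂                                        ≡⟨ ℤ.neg-involutive x₂ ⟨
    - (- x₂)                                  ≡⟨ cong -_ (ℤ.a≡a%ℕn+[a/ℕn]*n (- x₂) M) ⟩
    - (+ ((- x₂) %ℕ M) + (- x₂) /ℕ M * + M)   ≡⟨ shape (+ ((- x₂) %ℕ M)) ((- x₂) /ℕ M) (x₁ /ℕ M) (+ M) ⟩
    - + ((- x₂) %ℕ M) + (x₁ /ℕ M * 0ℤ + - ((- x₂) /ℕ M) * + M) ∎
    where
    open ≡-Reasoning
    shape : ∀ r q q′ M → - (r + q * M) ≡ - r + (q′ * 0ℤ + - q * M)
    shape = solve-∀

det-axis : ∀ u w → InSpan (u ∷ w ∷ []) (det u w , 0ℤ) × InSpan (u ∷ w ∷ []) (0ℤ , det u w)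
det-axis (a , b) (c , d) =
  (d ∷ - b ∷ [] , cong₂ _,_ (cramer₁ a b c d) (cramer₂ a b c d)) ,
  (- c ∷ a ∷ [] , cong₂ _,_ (cramer₃ a b c d) (cramer₄ a b c d))
  where
  cramer₁ : ∀ a b c d → d * a + (- b * c + 0ℤ) ≡ a * d - b * c
  cramer₁ = solve-∀
  cramer₂ : ∀ a b c d → d * b + (- b * d + 0ℤ) ≡ 0ℤ
  cramer₂ = solve-∀
  cramer₃ : ∀ a b c d → - c * a + (a * c + 0ℤ) ≡ 0ℤ
  cramer₃ = solve-∀
  cramer₄ : ∀ a b c d → - c * b + (a * d + 0ℤ) ≡ a * d - b * c
  cramer₄ = solve-∀

positive-axis : ∀ {n} {gs : Vec ℤ² n} {D} → D ≢ 0ℤ → InSpan gs (D , 0ℤ) → InSpan gs (0ℤ , D) →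
                ∃ λ p → InSpan gs (+ suc p , 0ℤ) × InSpan gs (0ℤ , + suc p)
positive-axis {D = + zero}   D≢0 _  _  = ⊥-elim (D≢0 refl)
positive-axis {D = + suc p}  _   h∈ v∈ = p , h∈ , v∈
positive-axis {gs = gs} {D = -[1+ p ]} _ h∈ v∈ =
  p , subst (InSpan gs) (cong (_, 0ℤ) (ℤ.-1*i≡-i -[1+ p ])) (InSpan-* -1ℤ h∈)
    , subst (InSpan gs) (cong (0ℤ ,_) (ℤ.-1*i≡-i -[1+ p ])) (InSpan-* -1ℤ v∈)

realise : ∀ {n} {gs : Vec ℤ² n} p → InSpan gs (+ suc p , 0ℤ) → InSpan gs (0ℤ , + suc p) →
          ∀ {x} → InSpan gs x → ∃ λ P → All (InSpan gs) (generators P) × Λ P x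
realise {gs = gs} p h∈ v∈ {x} x∈ with residue (suc p) x
... | m , k , q₁ , q₂ , x≡ = gadget , generators⊆ h∈ v∈ V∈ , x∈Λ
  where
  open Gadget k m p
  V∈ : InSpan gs V
  V∈ = InSpan-cancelʳ (subst (InSpan gs) x≡ x∈) (InSpan-+ (InSpan-* q₁ h∈) (InSpan-* q₂ v∈))
  x∈Λ : Λ gadget x
  x∈Λ = subst (Λ gadget) (sym x≡)
    (InSpan-+ V∈Λ (InSpan-+ (InSpan-* q₁ horizontal∈Λ) (InSpan-* q₂ vertical∈Λ)))

lemma5p12 : (u w : ℤ²) → det u w ≢ 0ℤ →
    Σ ℕ (λ n → n > 0 × Σ (Tree n) (λ T → Σ (Tree n) (λ T' →
    (v : ℤ²) → InΛ T T' v ⇔ InSpan (u ∷ w ∷ []) v)))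
lemma5p12 u w det≢0 with positive-axis det≢0 (proj₁ (det-axis u w)) (proj₂ (det-axis u w))
... | p , h∈ , v∈ with realise p h∈ v∈ (InSpan-∈ (hereᵥ refl)) | realise p h∈ v∈ (InSpan-∈ (thereᵥ (hereᵥ refl)))
... | P , P⊆ , u∈P | Q , Q⊆ , w∈Q =
  size R , size>0 (left R) , left R , right R , λ v → Λ⇔span ⇔-∘ InΛ⇔⟨gens⟩ (left R) (right R)
  where
  R = P ⊗ Q
  R⊆ : All (InSpan (u ∷ w ∷ [])) (generators R)
  R⊆ = subst (All _) (sym (generators-⊗ P Q)) (All.++⁺ P⊆ Q⊆)
  Λ⇔span : ∀ {v} → Λ R v ⇔ InSpan (u ∷ w ∷ []) v
  Λ⇔span = InSpan-⇔ (λ g∈ → All.lookup R⊆ (∈-fromList⁻ g∈))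
    λ { (hereᵥ refl) → Λ-⊗ˡ P Q u∈P ; (thereᵥ (hereᵥ refl)) → Λ-⊗ʳ P Q w∈Q }
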